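{- For any endofunctor $P$ on $Set$, there is a canonical distributive law $\lambda:\int\! P(-)\Rightarrow P\!\int\!(-)$ of the endofunctor $P\circ-$ of $[Inj,Set]$ over the monad $\int$ on $[Inj,Set]$; its component at $H$ and $n$ is the canonical comparison map $\operatorname{colim}_{j}P(H(m))\to P(\operatorname{colim}_j H(m))$ induced by the maps $P(\rho_j)$.
   Context: $Inj$ is the category of natural numbers and injections; $[Inj,Set]$ is the category of functors $Inj\to Set$ and natural transformations; $P\circ-$ is post-composition with $P$. Every object $j:n\to m$ of the comma category $n/Inj$ is isomorphic to a canonical inclusion $n\to n+k$ for a unique $k$. The monad $\int$ on $[Inj,Set]$: for $H:Inj\to Set$, $\int\! H(n)$ is the colimit of $n/Inj\xrightarrow{cod}Inj\xrightarrow{H}Set$ with colimit injections $\rho_j:H(m)\to\int\!H(n)$ for $j:n\to m$; for an injection $i:n\to n'$, $\int\! H(i):\int\! H(n)\to\int\! H(n')$ is induced by the maps $\rho_{j'}\circ H(i+k):H(n+k)\to H(n'+k)\to\int\! H(n')$, where $j':n'\to n'+k$ is canonical and $i+k:n+k\to n'+k$ is $i$ on the first $n$ elements and the identity on the last $k$; for a natural transformation $\alpha$, $(\int\!\alpha)_n$ is induced by $\rho_j\circ\alpha_{n+k}$. The unit at $n$ is $\rho_{\mathrm{id}_n}:H(n)\to\int\! H(n)$, and the multiplication $\int\!\int\! H(n)\to\int\! H(n)$ is induced by the maps $\rho_{j_{k+l}}:H(n+k+l)\to\int\!H(n)$ from the doubly indexed colimit (over canonical $n\to n+k$ and $n+k\to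 n+k+l$), $j_{k+l}:n\to n+k+l$ canonical. A distributive law of an endofunctor $F$ over a monad $(T,\eta,\mu)$ is a natural transformation $\lambda:TF\Rightarrow FT$ with $\lambda\circ\eta F=F\eta$ and $\lambda\circ\mu F=F\mu\circ\lambda T\circ T\lambda$. -}

module Defs where

open import Level using (0ℓ) renaming (suc to lsuc)
open import Data.Nat using (ℕ; zero; suc; _+_)
open import Data.Nat.Properties using (+-assoc; +-identityʳ)
open import Data.Fin using (Fin; _↑ˡ_; _↑ʳ_; splitAt; join; cast; toℕ)
open import Data.Fin.Properties
  using (toℕ-injective; toℕ-↑ˡ; toℕ-↑ʳ; toℕ-cast; ↑ˡ-injective; ↑ʳ-injective;
         splitAt-↑ˡ; splitAt-↑ʳ; splitAt-join; join-splitAt)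
open import Data.Sum using (_⊎_; inj₁; inj₂; [_,_]′)
import Data.Sum as Sum
open import Data.Product using (Σ; _×_; _,_; proj₁; proj₂)
open import Data.Empty using (⊥; ⊥-elim)
open import Function using (Func; _∘_)
open import Relation.Binary using (Setoid; Rel)
open import Relation.Binary.PropositionalEquality as ≡
  using (_≡_; refl; _≗_)
open import Relation.Binary.Construct.Closure.Equivalence as EqC
  using (EqClosure)
open import Relation.Binary.Construct.Closure.ReflexiveTransitive
  using (Star; ε; _◅_)
open import Relation.Binary.Construct.Closure.Symmetric
  using (SymClosure; fwd; bwd)

-- Setoids (our model of Set: sets-with-quotients), maps between them

SET : Set₁
SET = Setoid 0ℓ 0ℓ

module _ {A B : SET} where
  open Setoid B
  _≐_ : Func A B → Func A B → Set
  f ≐ g = ∀ x → Func.to f x ≈ Func.to g x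

infixr 9 _∘F_
idF : {A : SET} → Func A A
idF = record { to = λ x → x ; cong = λ p → p }

_∘F_ : {A B C : SET} → Func B C → Func A B → Func A C
g ∘F f = record { to = Func.to g ∘ Func.to f ; cong = Func.cong g ∘ Func.cong f }

record Endofunctor : Set₁ where
  field
    F₀     : SET → SET
    F₁     : {A B : SET} → Func A B → Func (F₀ A) (F₀ B)
    F-resp : {A B : SET} {f g : Func A B} → f ≐ g → F₁ f ≐ F₁ g
    F-id   : {A : SET} → F₁ (idF {A}) ≐ idF
    F-∘    : {A B C : SET} (f : Func A B) (g : Func B C) →
             F₁ (g ∘F f) ≐ (F₁ g ∘F F₁ f)

record Inj (n m : ℕ) : Set where
  constructor inj
  field
    ap  : Fin n → Fin m
    ap-injective : ∀ {a b} → ap a ≡ ap b → a ≡ b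
open Inj public

_≈ᵢ_ : ∀ {n m} → Inj n m → Inj n m → Set
f ≈ᵢ g = ap f ≗ ap g

idᵢ : ∀ {n} → Inj n n
idᵢ = inj (λ a → a) (λ p → p)

infixr 9 _∘ᵢ_
_∘ᵢ_ : ∀ {n m p} → Inj m p → Inj n m → Inj n p
g ∘ᵢ f = inj (ap g ∘ ap f) (ap-injective f ∘ ap-injective g)

record Functor : Set₁ where
  field
    obj      : ℕ → SET
    hom      : ∀ {n m} → Inj n m → Func (obj n) (obj m)
    hom-resp : ∀ {n m} {f g : Inj n m} → f ≈ᵢ g → hom f ≐ hom g
    hom-id   : ∀ {n} → hom (idᵢ {n}) ≐ idF
    hom-∘    : ∀ {n m p} (f : Inj n m) (g : Inj m p) →
               hom (g ∘ᵢ f) ≐ (hom g ∘F hom f)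
  Obj : ℕ → Set
  Obj n = Setoid.Carrier (obj n)
  homₒ : ∀ {n m} → Inj n m → Obj n → Obj m
  homₒ f = Func.to (hom f)

record NatTrans (H G : Functor) : Set where
  private
    module H = Functor H
    module G = Functor G
  field
    η       : ∀ n → Func (H.obj n) (G.obj n)
    natural : ∀ {n m} (f : Inj n m) →
              (η m ∘F H.hom f) ≐ (G.hom f ∘F η n)

open import Data.Nat.Properties using (m≤m+n; <-irrefl; ≤-<-trans)
open import Data.Fin.Properties using (toℕ<n; splitAt⁻¹-↑ˡ; splitAt⁻¹-↑ʳ)
import Data.Sum.Properties as SumP

private
  ↑ˡ≢↑ʳ : ∀ {n k} (a : Fin n) (b : Fin k) → a ↑ˡ k ≡ n ↑ʳ b → ⊥
  ↑ˡ≢↑ʳ {n} {k} a b eq = <-irrefl refl (≤-<-trans (m≤m+n n (toℕ b))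
    (≡.subst (λ z → z Data.Nat.< n)
      (≡.trans (≡.sym (toℕ-↑ˡ a k)) (≡.trans (≡.cong toℕ eq) (toℕ-↑ʳ n b)))
      (toℕ<n a)))

data SplitView (n k : ℕ) : Fin (n + k) → Set where
  left  : (a : Fin n) → SplitView n k (a ↑ˡ k)
  right : (b : Fin k) → SplitView n k (n ↑ʳ b)

splitView : ∀ n k (a : Fin (n + k)) → SplitView n k a
splitView n k a with splitAt n a in eq
... | inj₁ a₀ = ≡.subst (SplitView n k) (splitAt⁻¹-↑ˡ eq) (left a₀)
... | inj₂ b  = ≡.subst (SplitView n k) (splitAt⁻¹-↑ʳ eq) (right b)

infixl 6 _⊕_
_⊕_ : ∀ {n n'} → Inj n n' → (k : ℕ) → Inj (n + k) (n' + k)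
_⊕_ {n} {n'} i k = inj f f-inj
  where
  f : Fin (n + k) → Fin (n' + k)
  f a = join n' k (Sum.map (ap i) (λ b → b) (splitAt n a))
  m-inj : ∀ s t → Sum.map (ap i) (λ b → b) s ≡ Sum.map (ap i) (λ b → b) t → s ≡ t
  m-inj (inj₁ x) (inj₁ y) e = ≡.cong inj₁ (ap-injective i (SumP.inj₁-injective e))
  m-inj (inj₂ x) (inj₂ y) e = ≡.cong inj₂ (SumP.inj₂-injective e)
  m-inj (inj₁ x) (inj₂ y) ()
  m-inj (inj₂ x) (inj₁ y) ()
  f-inj : ∀ {a b} → f a ≡ f b → a ≡ b
  f-inj {a} {b} e = ≡.trans (≡.sym (join-splitAt n k a))
    (≡.trans (≡.cong (join n k)
      (m-inj (splitAt n a) (splitAt n b)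
                 (≡.trans (≡.sym (splitAt-join n' k (Sum.map (ap i) (λ c → c) (splitAt n a))))
                 (≡.trans (≡.cong (splitAt n') e)
                   (splitAt-join n' k (Sum.map (ap i) (λ c → c) (splitAt n b)))))))
      (join-splitAt n k b))

⊕-↑ˡ : ∀ {n n'} (i : Inj n n') k a → ap (i ⊕ k) (a ↑ˡ k) ≡ ap i a ↑ˡ k
⊕-↑ˡ {n} i k a rewrite splitAt-↑ˡ n a k = refl

⊕-↑ʳ : ∀ {n n'} (i : Inj n n') k b → ap (i ⊕ k) (n ↑ʳ b) ≡ n' ↑ʳ b
⊕-↑ʳ {n} i k b rewrite splitAt-↑ʳ n k b = refl

⊕-resp : ∀ {n n'} {i j : Inj n n'} k → i ≈ᵢ j → (i ⊕ k) ≈ᵢ (j ⊕ k)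
⊕-resp {n} {i = i} {j} k e a with splitView n k a
... | left a₀ = ≡.trans (⊕-↑ˡ i k a₀) (≡.trans (≡.cong (_↑ˡ k) (e a₀)) (≡.sym (⊕-↑ˡ j k a₀)))
... | right b = ≡.trans (⊕-↑ʳ i k b) (≡.sym (⊕-↑ʳ j k b))

⊕-id : ∀ {n} k → (idᵢ {n} ⊕ k) ≈ᵢ idᵢ
⊕-id {n} k a with splitView n k a
... | left a₀ = ⊕-↑ˡ idᵢ k a₀
... | right b = ⊕-↑ʳ idᵢ k b

⊕-∘ : ∀ {n n' n''} (i : Inj n n') (j : Inj n' n'') k →
      ((j ∘ᵢ i) ⊕ k) ≈ᵢ ((j ⊕ k) ∘ᵢ (i ⊕ k))
⊕-∘ {n} i j k a with splitView n k a
... | left a₀ = ≡.trans (⊕-↑ˡ (j ∘ᵢ i) k a₀)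
      (≡.sym (≡.trans (≡.cong (ap (j ⊕ k)) (⊕-↑ˡ i k a₀)) (⊕-↑ˡ j k (ap i a₀))))
... | right b = ≡.trans (⊕-↑ʳ (j ∘ᵢ i) k b)
      (≡.sym (≡.trans (≡.cong (ap (j ⊕ k)) (⊕-↑ʳ i k b)) (⊕-↑ʳ j k b)))

castI : ∀ {m m'} → m ≡ m' → Inj m m'
castI e = inj (cast e) (λ {a} {b} p → toℕ-injective
  (≡.trans (≡.sym (toℕ-cast e a)) (≡.trans (≡.cong toℕ p) (toℕ-cast e b))))

-- The colimit  ∫H(n) = colim (n/Inj --cod--> Inj --H--> Set).
-- Every object of n/Inj is isomorphic to a canonical inclusion
-- n → n + k, so we index by these: an element is a pair (k , x) with
-- x ∈ H(n + k) (this pair is ρ_k(x)); the generating relation identifies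
-- (k , x) with (k' , H(f)(x)) for every morphism f of n/Inj from
-- n → n+k to n → n+k', i.e. every injection f : n+k → n+k' with
-- f ∘ (canonical) = (canonical).

module _ (H : Functor) (n : ℕ) where
  open Functor H

  ColimCarrier : Set
  ColimCarrier = Σ ℕ (λ k → Obj (n + k))

  Under : ℕ → ℕ → Set
  Under k k' = Σ (Inj (n + k) (n + k')) λ f → ∀ a → ap f (a ↑ˡ k) ≡ a ↑ˡ k'

  Gen : Rel ColimCarrier 0ℓ
  Gen (k , x) (k' , y) =
    Σ (Under k k') λ f → Setoid._≈_ (obj (n + k')) (homₒ (proj₁ f) x) y

  Colim : SET
  Colim = EqC.setoid Gen

module ColimProps (H : Functor) where
  open Functor H

  step : ∀ {n k} {x y : Obj (n + k)} → Setoid._≈_ (obj (n + k)) x y →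
         Setoid._≈_ (Colim H n) (k , x) (k , y)
  step {n} {k} p = fwd ((idᵢ , λ a → refl) , Setoid.trans (obj (n + k)) (hom-id _) p) ◅ ε

  ρ : ∀ n k → Func (obj (n + k)) (Colim H n)
  ρ n k = record { to = λ x → (k , x) ; cong = step }

open ColimProps public using (ρ)

private
  module Ext {n n' k k' : ℕ} (i : Inj n n') (f : Inj (n + k) (n + k'))
             (fix : ∀ a → ap f (a ↑ˡ k) ≡ a ↑ˡ k') where

    g : Fin (n' + k) → Fin (n' + k')
    g a = [ (λ a' → a' ↑ˡ k') , (λ b → ap (i ⊕ k') (ap f (n ↑ʳ b))) ]′ (splitAt n' a)

    g-↑ˡ : ∀ a → g (a ↑ˡ k) ≡ a ↑ˡ k'
    g-↑ˡ a rewrite splitAt-↑ˡ n' a k = refl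

    g-↑ʳ : ∀ b → g (n' ↑ʳ b) ≡ ap (i ⊕ k') (ap f (n ↑ʳ b))
    g-↑ʳ b rewrite splitAt-↑ʳ n' k b = refl

    noClash' : ∀ a b v → ap f (n ↑ʳ b) ≡ v → SplitView n k' v →
               a ↑ˡ k' ≡ ap (i ⊕ k') v → ⊥
    noClash' a b _ eq (left c) e =
      ↑ˡ≢↑ʳ c b (≡.sym (ap-injective f (≡.trans eq (≡.sym (fix c)))))
    noClash' a b _ eq (right c) e = ↑ˡ≢↑ʳ a c (≡.trans e (⊕-↑ʳ i k' c))

    noClash : ∀ a b → a ↑ˡ k' ≡ ap (i ⊕ k') (ap f (n ↑ʳ b)) → ⊥
    noClash a b = noClash' a b _ refl (splitView n k' (ap f (n ↑ʳ b)))

    g-inj' : ∀ {a b} → SplitView n' k a → SplitView n' k b → g a ≡ g b → a ≡ b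
    g-inj' (left a) (left b) e = ≡.cong (_↑ˡ k)
      (↑ˡ-injective k' a b (≡.trans (≡.sym (g-↑ˡ a)) (≡.trans e (g-↑ˡ b))))
    g-inj' (right a) (right b) e = ≡.cong (n' ↑ʳ_) (↑ʳ-injective n a b
      (ap-injective f (ap-injective (i ⊕ k') (≡.trans (≡.sym (g-↑ʳ a)) (≡.trans e (g-↑ʳ b))))))
    g-inj' (left a) (right b) e =
      ⊥-elim (noClash a b (≡.trans (≡.sym (g-↑ˡ a)) (≡.trans e (g-↑ʳ b))))
    g-inj' (right a) (left b) e =
      ⊥-elim (noClash b a (≡.trans (≡.sym (g-↑ˡ b)) (≡.trans (≡.sym e) (g-↑ʳ a))))

    ext : Inj (n' + k) (n' + k')
    ext = inj g (λ {a} {b} → g-inj' (splitView n' k a) (splitView n' k b))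

    ext-fix : ∀ a → ap ext (a ↑ˡ k) ≡ a ↑ˡ k'
    ext-fix = g-↑ˡ

    ext-comm' : ∀ {a} → SplitView n k a → ap ext (ap (i ⊕ k) a) ≡ ap (i ⊕ k') (ap f a)
    ext-comm' (left a) = ≡.trans (≡.cong g (⊕-↑ˡ i k a))
      (≡.trans (g-↑ˡ (ap i a)) (≡.trans (≡.sym (⊕-↑ˡ i k' a)) (≡.cong (ap (i ⊕ k')) (≡.sym (fix a)))))
    ext-comm' (right b) = ≡.trans (≡.cong g (⊕-↑ʳ i k b)) (g-↑ʳ b)

    ext-comm : (ext ∘ᵢ (i ⊕ k)) ≈ᵢ ((i ⊕ k') ∘ᵢ f)
    ext-comm a = ext-comm' (splitView n k a)

module IntFunctor (H : Functor) where
  open Functor H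
  open ColimProps H using (step)

  intHom₀ : ∀ {n n'} → Inj n n' → ColimCarrier H n → ColimCarrier H n'
  intHom₀ i (k , x) = (k , homₒ (i ⊕ k) x)

  intHom-gen : ∀ {n n'} (i : Inj n n') {u v} → Gen H n u v →
               Setoid._≈_ (Colim H n') (intHom₀ i u) (intHom₀ i v)
  intHom-gen {n} {n'} i {k , x} {k' , y} ((f , fix) , p) =
    fwd ((E.ext , E.ext-fix) , prf) ◅ ε
    where
    module E = Ext i f fix
    open Setoid (obj (n' + k'))
    prf : homₒ E.ext (homₒ (i ⊕ k) x) ≈ homₒ (i ⊕ k') y
    prf = trans (sym (hom-∘ (i ⊕ k) E.ext x))
          (trans (hom-resp E.ext-comm x)
          (trans (hom-∘ f (i ⊕ k') x) (Func.cong (hom (i ⊕ k')) p)))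

  intHom : ∀ {n n'} → Inj n n' → Func (Colim H n) (Colim H n')
  intHom {n} {n'} i = record
    { to = intHom₀ i
    ; cong = EqC.gfold (Setoid.isEquivalence (Colim H n')) (intHom₀ i) (intHom-gen i) }

  ∫_ : Functor
  ∫_ = record
    { obj = Colim H
    ; hom = intHom
    ; hom-resp = λ {n} {m} {i} {j} e → λ { (k , x) → step (hom-resp (⊕-resp {i = i} {j} k e) x) }
    ; hom-id = λ { {n} (k , x) → step (trans' (hom-resp (⊕-id k) x) (hom-id x)) }
    ; hom-∘ = λ i j → λ { (k , x) → step (trans' (hom-resp (⊕-∘ i j k) x) (hom-∘ (i ⊕ k) (j ⊕ k) x)) }
    }
    where
    trans' : ∀ {m} {a b c : Obj m} → Setoid._≈_ (obj m) a b → Setoid._≈_ (obj m) b c → Setoid._≈_ (obj m) a c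
    trans' {m} = Setoid.trans (obj m)

open IntFunctor public using (∫_)

private
  toℕ-inj : ∀ {m} {a b : Fin m} → toℕ a ≡ toℕ b → a ≡ b
  toℕ-inj = toℕ-injective

assocI : ∀ n k l → Inj ((n + k) + l) (n + (k + l))
assocI n k l = castI (+-assoc n k l)

assocI⁻ : ∀ n k l → Inj (n + (k + l)) ((n + k) + l)
assocI⁻ n k l = castI (≡.sym (+-assoc n k l))

private
  assoc-↑ˡ : ∀ n k l (b : Fin n) → ap (assocI n k l) ((b ↑ˡ k) ↑ˡ l) ≡ b ↑ˡ (k + l)
  assoc-↑ˡ n k l b = toℕ-inj (≡.trans (toℕ-cast _ _) (≡.trans (toℕ-↑ˡ (b ↑ˡ k) l)
    (≡.trans (toℕ-↑ˡ b k) (≡.sym (toℕ-↑ˡ b (k + l))))))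

  assoc⁻-↑ˡ : ∀ n k l (b : Fin n) → ap (assocI⁻ n k l) (b ↑ˡ (k + l)) ≡ (b ↑ˡ k) ↑ˡ l
  assoc⁻-↑ˡ n k l b = toℕ-inj (≡.trans (toℕ-cast _ _) (≡.trans (toℕ-↑ˡ b (k + l))
    (≡.sym (≡.trans (toℕ-↑ˡ (b ↑ˡ k) l) (toℕ-↑ˡ b k)))))

  assoc⁻∘assoc : ∀ n k l y → ap (assocI⁻ n k l) (ap (assocI n k l) y) ≡ y
  assoc⁻∘assoc n k l y = toℕ-inj (≡.trans (toℕ-cast (≡.sym (+-assoc n k l)) (ap (assocI n k l) y))
    (toℕ-cast (+-assoc n k l) y))

module Monad (H : Functor) where
  open Functor H

  -- unit: H(n) → ∫H(n), the colimit injection ρ_{id_n} (id_n ≅ n → n + 0)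
  unit₀ : ∀ n → Obj n → ColimCarrier H n
  unit₀ n x = (0 , homₒ (castI (≡.sym (+-identityʳ n))) x)

  unit : ∀ n → Func (obj n) (Colim H n)
  unit n = record { to = unit₀ n
                  ; cong = λ p → ColimProps.step H (Func.cong (hom (castI (≡.sym (+-identityʳ n)))) p) }

  mult₀ : ∀ n → ColimCarrier (∫ H) n → ColimCarrier H n
  mult₀ n (k , (l , x)) = (k + l , homₒ (assocI n k l) x)

  private
    conjGen : ∀ {n k l k' l'} (f : Inj ((n + k) + l) ((n + k') + l'))
              (fix : ∀ b → ap f ((b ↑ˡ k) ↑ˡ l) ≡ (b ↑ˡ k') ↑ˡ l') {x y} →
              Setoid._≈_ (obj ((n + k') + l')) (homₒ f x) y →
              Gen H n (k + l , homₒ (assocI n k l) x) (k' + l' , homₒ (assocI n k' l') y)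
    conjGen {n} {k} {l} {k'} {l'} f fix {x} {y} q = ((g , gfix) , prf)
      where
      a = assocI n k l
      a' = assocI n k' l'
      g = a' ∘ᵢ f ∘ᵢ assocI⁻ n k l
      gfix : ∀ b → ap g (b ↑ˡ (k + l)) ≡ b ↑ˡ (k' + l')
      gfix b = ≡.trans (≡.cong (ap a' ∘ ap f) (assoc⁻-↑ˡ n k l b))
               (≡.trans (≡.cong (ap a') (fix b)) (assoc-↑ˡ n k' l' b))
      open Setoid (obj (n + (k' + l')))
      prf : homₒ g (homₒ a x) ≈ homₒ a' y
      prf = trans (sym (hom-∘ a g x))
            (trans (hom-resp {f = g ∘ᵢ a} {g = a' ∘ᵢ f}
                     (λ z → ≡.cong (ap a' ∘ ap f) (assoc⁻∘assoc n k l z)) x)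
            (trans (hom-∘ f a' x) (Func.cong (hom a') q)))

    inner : ∀ {n k'} {u v} → Gen H (n + k') u v →
            Setoid._≈_ (Colim H n) (mult₀ n (k' , u)) (mult₀ n (k' , v))
    inner {n} {k'} {l , y} {l' , z} ((h , fixh) , q) =
      fwd (conjGen h (λ b → fixh (b ↑ˡ k')) q) ◅ ε

    innerC : ∀ {n k'} {u v} → Setoid._≈_ (Colim H (n + k')) u v →
             Setoid._≈_ (Colim H n) (mult₀ n (k' , u)) (mult₀ n (k' , v))
    innerC {n} {k'} = EqC.gfold (Setoid.isEquivalence (Colim H n))
                        (λ u → mult₀ n (k' , u)) inner

    outer : ∀ {n} {u v} → Gen (∫ H) n u v →
            Setoid._≈_ (Colim H n) (mult₀ n u) (mult₀ n v)
    outer {n} {k , (l , x)} {k' , v} ((f , fix) , p) =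
      Setoid.trans (Colim H n)
        (fwd (conjGen (f ⊕ l) (λ b → ≡.trans (⊕-↑ˡ f l (b ↑ˡ k)) (≡.cong (_↑ˡ l) (fix b)))
               (Setoid.refl (obj ((n + k') + l)))) ◅ ε)
        (innerC p)

  mult : ∀ n → Func (Colim (∫ H) n) (Colim H n)
  mult n = record { to = mult₀ n
                  ; cong = EqC.gfold (Setoid.isEquivalence (Colim H n)) (mult₀ n) outer }

open Monad public using (unit; mult)

intMap : {H G : Functor} → (∀ m → Functor.Obj H m → Functor.Obj G m) →
         ∀ n → ColimCarrier H n → ColimCarrier G n
intMap α n (k , x) = (k , α (n + k) x)

∫₁ : {H G : Functor} → NatTrans H G → ∀ n → Func (Colim H n) (Colim G n)
∫₁ {H} {G} α n = record
  { to = intMap {H} {G} (λ m → Func.to (NatTrans.η α m)) n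
  ; cong = EqC.gfold (Setoid.isEquivalence (Colim G n)) _ gen }
  where
  gen : ∀ {u v} → Gen H n u v → Setoid._≈_ (Colim G n)
          (intMap {H} {G} (λ m → Func.to (NatTrans.η α m)) n u) (intMap {H} {G} (λ m → Func.to (NatTrans.η α m)) n v)
  gen {k , x} {k' , y} ((f , fix) , p) =
    fwd ((f , fix) , Setoid.trans (Functor.obj G (n + k'))
                       (Setoid.sym (Functor.obj G (n + k')) (NatTrans.natural α f x))
                       (Func.cong (NatTrans.η α (n + k')) p)) ◅ ε

infixr 9 _∘ₚ_
_∘ₚ_ : Endofunctor → Functor → Functor
P ∘ₚ H = record
  { obj = λ n → F₀ (obj n)
  ; hom = λ f → F₁ (hom f)
  ; hom-resp = λ e → F-resp (hom-resp e)
  ; hom-id = λ {n} y → Setoid.trans (F₀ (obj n)) (F-resp hom-id y) (F-id y)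
  ; hom-∘ = λ {n} {m} {p} f g y →
      Setoid.trans (F₀ (obj p)) (F-resp (hom-∘ f g) y) (F-∘ (hom f) (hom g) y)
  }
  where
  open Endofunctor P
  open Functor H

comparison : (P : Endofunctor) (H : Functor) (n : ℕ) →
             ColimCarrier (P ∘ₚ H) n → Setoid.Carrier (Endofunctor.F₀ P (Colim H n))
comparison P H n (k , p) = Func.to (Endofunctor.F₁ P (ρ H n k)) p

record IsDistributiveLaw (P : Endofunctor)
  (lam : ∀ H n → ColimCarrier (P ∘ₚ H) n → Setoid.Carrier (Endofunctor.F₀ P (Colim H n)))
  : Set₁ where
  open Endofunctor P
  field
    lam-cong : ∀ H n {u v} → Setoid._≈_ (Colim (P ∘ₚ H) n) u v →
               Setoid._≈_ (F₀ (Colim H n)) (lam H n u) (lam H n v)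
    lam-natural-n : ∀ H {n n'} (i : Inj n n') u →
               Setoid._≈_ (F₀ (Colim H n'))
                 (lam H n' (Functor.homₒ (∫ (P ∘ₚ H)) i u))
                 (Func.to (F₁ (Functor.hom (∫ H) i)) (lam H n u))
    lam-natural-H : ∀ H G (α : NatTrans H G) n u →
               Setoid._≈_ (F₀ (Colim G n))
                 (lam G n (intMap {P ∘ₚ H} {P ∘ₚ G} (λ m → Func.to (F₁ (NatTrans.η α m))) n u))
                 (Func.to (F₁ (∫₁ α n)) (lam H n u))
    lam-unit : ∀ H n p →
               Setoid._≈_ (F₀ (Colim H n))
                 (lam H n (Func.to (unit (P ∘ₚ H) n) p))
                 (Func.to (F₁ (unit H n)) p)
    lam-mult : ∀ H n w →
               Setoid._≈_ (F₀ (Colim H n))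
                 (lam H n (Func.to (mult (P ∘ₚ H) n) w))
                 (Func.to (F₁ (mult H n)) (lam (∫ H) n (intMap {∫ (P ∘ₚ H)} {P ∘ₚ ∫ H} (lam H) n w)))

module Submission where

-- Every clause of the law is an instance of one principle: a functor P maps
-- commuting triangles and squares of setoid maps to commuting ones.

open import Defs
open import Data.Nat using (ℕ; _+_)
open import Data.Nat.Properties using (+-identityʳ)
open import Data.Product using (_,_; proj₁)
open import Function using (Func)
open import Relation.Binary using (Setoid)
open import Relation.Binary.PropositionalEquality using (sym)
import Relation.Binary.Construct.Closure.Equivalence as EqC
open import Relation.Binary.Construct.Closure.ReflexiveTransitive using (ε; _◅_)
open import Relation.Binary.Construct.Closure.Symmetric using (bwd)

module EndofunctorProps (P : Endofunctor) where
  open Endofunctor P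

  F-triangle : {A B C : SET} (f : Func A B) (g : Func B C) (h : Func A C) →
               (g ∘F f) ≐ h → ∀ x →
               Setoid._≈_ (F₀ C) (Func.to (F₁ g) (Func.to (F₁ f) x)) (Func.to (F₁ h) x)
  F-triangle {C = C} f g h gf≐h x =
    Setoid.trans (F₀ C) (Setoid.sym (F₀ C) (F-∘ f g x)) (F-resp gf≐h x)

  F-square : {A B B' C : SET} (f : Func A B) (g : Func B C) (f' : Func A B') (g' : Func B' C) →
             (g ∘F f) ≐ (g' ∘F f') → ∀ x →
             Setoid._≈_ (F₀ C) (Func.to (F₁ g) (Func.to (F₁ f) x)) (Func.to (F₁ g') (Func.to (F₁ f') x))
  F-square {C = C} f g f' g' square x =
    Setoid.trans (F₀ C) (F-triangle f g (g' ∘F f') square x) (F-∘ f' g' x)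

  F-square₃ : {A B C B' D : SET} (f : Func A B) (g : Func B C) (h : Func C D)
              (f' : Func A B') (g' : Func B' D) →
              (h ∘F (g ∘F f)) ≐ (g' ∘F f') → ∀ x →
              Setoid._≈_ (F₀ D) (Func.to (F₁ h) (Func.to (F₁ g) (Func.to (F₁ f) x)))
                                (Func.to (F₁ g') (Func.to (F₁ f') x))
  F-square₃ {D = D} f g h f' g' pentagon x =
    Setoid.trans (F₀ D) (Func.cong (F₁ h) (Setoid.sym (F₀ _) (F-∘ f g x)))
                        (F-square (g ∘F f) h f' g' pentagon x)

module IntegralProps (H : Functor) where
  open Functor H

  ρ-cocone : ∀ {n k k'} (f : Under H n k k') → (ρ H n k' ∘F hom (proj₁ f)) ≐ ρ H n k
  ρ-cocone {n} {k' = k'} f x = bwd (f , Setoid.refl (obj (n + k'))) ◅ ε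

  ∫-hom-on-ρ : ∀ {n n'} (i : Inj n n') k →
               (Functor.hom (∫ H) i ∘F ρ H n k) ≐ (ρ H n' k ∘F hom (i ⊕ k))
  ∫-hom-on-ρ {n' = n'} i k x = Setoid.refl (Colim H n')

  unit-on-ρ : ∀ n → (ρ H n 0 ∘F hom (castI (sym (+-identityʳ n)))) ≐ unit H n
  unit-on-ρ n x = Setoid.refl (Colim H n)

  mult-on-ρρ : ∀ n k l →
               (mult H n ∘F (ρ (∫ H) n k ∘F ρ H (n + k) l)) ≐ (ρ H n (k + l) ∘F hom (assocI n k l))
  mult-on-ρρ n k l x = Setoid.refl (Colim H n)

∫₁-on-ρ : {H G : Functor} (α : NatTrans H G) (n k : ℕ) →
          (∫₁ α n ∘F ρ H n k) ≐ (ρ G n k ∘F NatTrans.η α (n + k))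
∫₁-on-ρ {G = G} α n k x = Setoid.refl (Colim G n)

module ComparisonProps (P : Endofunctor) where
  open Endofunctor P
  open EndofunctorProps P

  -- λ_{H,n} identifies the generating pairs of the colimit of P ∘ H,
  -- because P carries the cocone ρ of H to a cocone
  comparison-gen : ∀ H n {u v} → Gen (P ∘ₚ H) n u v →
                   Setoid._≈_ (F₀ (Colim H n)) (comparison P H n u) (comparison P H n v)
  comparison-gen H n {k , x} {k' , y} (f , Pf[x]≈y) =
    Setoid.trans (F₀ (Colim H n))
      (Setoid.sym (F₀ (Colim H n))
        (F-triangle (Functor.hom H (proj₁ f)) (ρ H n k') (ρ H n k) (IntegralProps.ρ-cocone H f) x))
      (Func.cong (F₁ (ρ H n k')) Pf[x]≈y)

  comparison-cong : ∀ H n {u v} → Setoid._≈_ (Colim (P ∘ₚ H) n) u v →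
                    Setoid._≈_ (F₀ (Colim H n)) (comparison P H n u) (comparison P H n v)
  comparison-cong H n =
    EqC.gfold (Setoid.isEquivalence (F₀ (Colim H n))) (comparison P H n) (comparison-gen H n)

  comparison-induced : ∀ H G {n n' k k'} (φ : Func (Colim H n) (Colim G n'))
                       (h : Func (Functor.obj H (n + k)) (Functor.obj G (n' + k'))) →
                       (φ ∘F ρ H n k) ≐ (ρ G n' k' ∘F h) → ∀ p →
                       Setoid._≈_ (F₀ (Colim G n'))
                         (comparison P G n' (k' , Func.to (F₁ h) p))
                         (Func.to (F₁ φ) (comparison P H n (k , p)))
  comparison-induced H G {n' = n'} φ h induced p =
    F-square h (ρ G n' _) (ρ H _ _) φ (λ x → Setoid.sym (Colim G n') (induced x)) p

proposition26 : (P : Endofunctor) → IsDistributiveLaw P (comparison P)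
proposition26 P = record
  { lam-cong      = comparison-cong
  ; lam-natural-n = λ H i → λ { (k , p) →
      comparison-induced H H (Functor.hom (∫ H) i) (Functor.hom H (i ⊕ k))
        (IntegralProps.∫-hom-on-ρ H i k) p }
  ; lam-natural-H = λ H G α n → λ { (k , p) →
      comparison-induced H G (∫₁ α n) (NatTrans.η α (n + k)) (∫₁-on-ρ α n k) p }
  ; lam-unit      = λ H n p →
      F-triangle (Functor.hom H (castI (sym (+-identityʳ n)))) (ρ H n 0) (unit H n)
        (IntegralProps.unit-on-ρ H n) p
  ; lam-mult      = λ H n → λ { (k , (l , p)) →
      Setoid.sym (F₀ (Colim H n))
        (F-square₃ (ρ H (n + k) l) (ρ (∫ H) n k) (mult H n)
          (Functor.hom H (assocI n k l)) (ρ H n (k + l)) (IntegralProps.mult-on-ρρ H n k l) p) }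
  }
  where
  open Endofunctor P
  open EndofunctorProps P
  open ComparisonProps P
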